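{- There is a computable function $h_0:\mathbb N\times\mathbb N\times\mathbb N^+\to\mathbb N^+$ such that for every $d\in\mathbb N$, $k\in\mathbb N^+$ and every $d$-degree-extreme graph $G$: either (i) $|V^G_{[1,d]}|>(d+1)\cdot(k-1)^2$, or (ii) the structure $\mathcal A:=\mathcal A(G,d)$ satisfies $\mathrm{ltw}(\mathcal A,r)\le h_0(r,d,k)$ for every $r\in\mathbb N$.
   Context: Graphs are simple, finite, with nonempty vertex set. $G=(V,E)$ is $d$-degree-extreme if each $v\in V$ has $\deg(v)\le d$ or $\deg(v)\ge|V|-1-d$. $V^G_{[1,d]}:=\{v\in V:1\le\deg(v)\le d\}$ and $V^G_{\le d}:=\{v\in V:\deg(v)\le d\}$. $\mathcal A(G,d)$ is the structure over vocabulary $\{P,R\}$ ($P$ unary, $R$ binary) with universe $V$, $P^{\mathcal A}:=V^G_{\le d}$, and $R^{\mathcal A}:=\{(u,v):\{u,v\}\in E \text{ and } (u\in V^G_{\le d}\text{ or } v\in V^G_{\le d})\}\cup\{(u,v):\{u,v\}\notin E,\ u,v\in V\setminus V^G_{\le d},\ u\ne v\}$. The Gaifman graph of a structure has the universe as vertices and an edge between distinct $a,b$ iff they occur together in some tuple of some relation. For $r\in\mathbb N$, $\mathcal N^{\mathcal A}_r(a)$ is the substructure induced on the set of elements at Gaifman distance at most $r$ from $a$; the tree-width of a structure is that of its Gaifman graph; $\mathrm{ltw}(\mathcal A,r):=\max_{a\in A}\mathrm{tw}(\mathcal N^{\mathcal A}_r(a))$. -}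

module Defs where

open import Data.Nat using (ℕ; zero; suc; _+_; _*_; _∸_; _^_; _≤_; _<_; _≤?_; NonZero)
open import Data.Fin using (Fin; toℕ; inject₁) renaming (suc to fsuc)
open import Data.Fin.Subset using (Subset; ∣_∣; _∈_)
open import Data.Vec using (tabulate)
open import Data.Bool using (Bool; true; false; _∧_)
open import Data.Product using (Σ; Σ-syntax; ∃; ∃-syntax; _×_; _,_; proj₁)
open import Data.Sum using (_⊎_)
open import Relation.Nullary using (¬_)
open import Relation.Nullary.Decidable using (⌊_⌋)
open import Relation.Binary.PropositionalEquality using (_≡_; _≢_)

ℕ⁺ : Set
ℕ⁺ = Σ[ k ∈ ℕ ] NonZero k

record Graph : Set where
  field
    n        : ℕ
    nonempty : 1 ≤ n
    adj      : Fin n → Fin n → Bool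
    sym      : ∀ u v → adj u v ≡ adj v u
    irrefl   : ∀ v → adj v v ≡ false

module _ (G : Graph) where
  open Graph G

  deg : Fin n → ℕ
  deg v = ∣ tabulate (adj v) ∣

  DegreeExtreme : ℕ → Set
  DegreeExtreme d = ∀ v → deg v ≤ d ⊎ n ∸ 1 ∸ d ≤ deg v

  V[1,d] : ℕ → Subset n
  V[1,d] d = tabulate (λ v → ⌊ 1 ≤? deg v ⌋ ∧ ⌊ deg v ≤? d ⌋)

  V≤ : ℕ → Fin n → Set
  V≤ d v = deg v ≤ d

record Structure : Set₁ where
  field
    size : ℕ
    P    : Fin size → Set
    R    : Fin size → Fin size → Set

𝒜 : Graph → ℕ → Structure
𝒜 G d = record
  { size = n
  ; P    = V≤ G d
  ; R    = λ u v →
      (adj u v ≡ true × (V≤ G d u ⊎ V≤ G d v))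
      ⊎ (adj u v ≡ false × ¬ V≤ G d u × ¬ V≤ G d v × u ≢ v)
  }
  where open Graph G

module _ (𝔄 : Structure) where
  open Structure 𝔄

  -- Gaifman graph: distinct a, b occurring together in a tuple.
  -- (Tuples of the unary P contain a single element, so only R contributes.)
  GaifmanEdge : Fin size → Fin size → Set
  GaifmanEdge a b = a ≢ b × (R a b ⊎ R b a)

  DistLe : ℕ → Fin size → Fin size → Set
  DistLe zero    a b = a ≡ b
  DistLe (suc r) a b = DistLe r a b ⊎ (∃[ c ] (GaifmanEdge a c × DistLe r c b))

  Ball : ℕ → Fin size → Fin size → Set
  Ball r a b = DistLe r a b

  InducedGaifmanEdge : (Fin size → Set) → Fin size → Fin size → Set
  InducedGaifmanEdge S a b = S a × S b × GaifmanEdge a b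

-- Trees and tree decompositions
-- A finite tree with node set Fin (suc m): every node fsuc i has a parent
-- `parent i` with smaller index; edges are {fsuc i , parent i}.
-- (Every finite nonempty tree is isomorphic to one of this form.)

record Tree : Set where
  field
    m      : ℕ
    parent : Fin m → Fin (suc m)
    parent< : ∀ i → toℕ (parent i) ≤ toℕ i

  Node : Set
  Node = Fin (suc m)

  TEdge : Node → Node → Set
  TEdge s t = ∃[ i ] ((s ≡ fsuc i × t ≡ parent i) ⊎ (t ≡ fsuc i × s ≡ parent i))

  data PathIn (Q : Node → Set) : Node → Node → Set where
    here  : ∀ {s} → Q s → PathIn Q s s
    there : ∀ {s u t} → Q s → TEdge s u → PathIn Q u t → PathIn Q s t

record TreeDecomposition {n : ℕ} (S : Fin n → Set) (E : Fin n → Fin n → Set)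
                         (w : ℕ) : Set where
  field
    T     : Tree
  open Tree T
  field
    bag       : Node → Subset n
    bag⊆S     : ∀ t v → v ∈ bag t → S v
    coverV    : ∀ v → S v → ∃[ t ] (v ∈ bag t)
    coverE    : ∀ u v → E u v → ∃[ t ] (u ∈ bag t × v ∈ bag t)
    connected : ∀ v t₁ t₂ → v ∈ bag t₁ → v ∈ bag t₂ →
                PathIn (λ t → v ∈ bag t) t₁ t₂
    width     : ∀ t → ∣ bag t ∣ ≤ suc w

TwLe : {n : ℕ} → (Fin n → Set) → (Fin n → Fin n → Set) → ℕ → Set
TwLe S E w = TreeDecomposition S E w

NeighbourhoodTwLe : (𝔄 : Structure) → ℕ → Fin (Structure.size 𝔄) → ℕ → Set
NeighbourhoodTwLe 𝔄 r a w =
  TwLe (Ball 𝔄 r a) (InducedGaifmanEdge 𝔄 (Ball 𝔄 r a)) w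

LtwLe : Structure → ℕ → ℕ → Set
LtwLe 𝔄 r w = ∀ a → NeighbourhoodTwLe 𝔄 r a w

-- If (i) fails, the Gaifman graph of 𝒜(G,d) has maximum degree at most
-- D = d + (d+1)(k-1)², so every r-ball has at most (D+1)^r elements and a
-- tree decomposition with one bag gives tw(𝒩_r(a)) ≤ (D+1)^r.  For the
-- degree bound: a vertex of degree ≤ d keeps only its G-neighbours; any other
-- vertex a is joined in 𝒜 to its low-degree G-neighbours, which lie in
-- V_[1,d], and to its G-non-neighbours, of which there are at most d because
-- deg a ≥ |V| - 1 - d.
module Submission where

open import Defs
open import Data.Bool using (Bool; true; false; _∧_)
import Data.Bool.Properties as Bool
open import Data.Empty using (⊥; ⊥-elim)
open import Data.Fin using (Fin; zero; suc)
open import Data.Fin.Properties using (_≟_)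
open import Data.Fin.Subset
  using (Subset; inside; outside; ∣_∣; _∈_; _∉_; _∪_; ⁅_⁆; ∁; _-_; _⊆_) renaming (⊥ to ∅)
open import Data.Fin.Subset.Properties
  using (∉⊥; ∣⊥∣≡0; x∈⁅x⁆; x∈⁅y⁆⇒x≡y; ∣⁅x⁆∣≡1; x∈p∪q⁺; x∈p∪q⁻; p⊆q⇒∣p∣≤∣q∣;
         ∣∁p∣≡n∸∣p∣; x∉p⇒x∈∁p; x∈p∧x≢y⇒x∈p-y; x∈p⇒∣p-x∣<∣p∣)
open import Data.Nat using (ℕ; zero; suc; _+_; _*_; _∸_; _^_; _≤_; _<_; z≤n; s≤s; s≤s⁻¹; _≤?_)
open import Data.Nat.Properties
  using (≤-trans; ≤-reflexive; n≤1+n; +-mono-≤; +-monoʳ-≤; *-monoˡ-≤; +-suc; +-comm;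
         m≤m+n; m≤n+m∸n; m≤n+o⇒m∸n≤o; ∸-+-assoc; m^n≢0; ≰⇒>; module ≤-Reasoning)
open import Data.Product using (Σ-syntax; ∃-syntax; _×_; _,_; proj₁)
open import Data.Sum using (_⊎_; inj₁; inj₂; swap)
open import Data.Vec using ([]; _∷_; tabulate; here; there)
open import Data.Vec.Properties using (lookup∘tabulate; lookup⇒[]=; []=⇒lookup)
open import Function using (_∘_; case_of_; Equivalence)
open import Relation.Binary using (Decidable)
open import Relation.Binary.PropositionalEquality using (_≡_; refl; sym; trans; cong₂)
open import Relation.Nullary using (Dec; yes; no; ¬_)
open import Relation.Nullary.Decidable
  using (⌊_⌋; isYes≗does; dec-true; toWitness; _×-dec_; _⊎-dec_; ¬?)

isYes-true : ∀ {A : Set} (a? : Dec A) → A → ⌊ a? ⌋ ≡ true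
isYes-true a? a = trans (isYes≗does a?) (dec-true a? a)

x∈tabulate⁺ : ∀ {n} (f : Fin n → Bool) {x} → f x ≡ true → x ∈ tabulate f
x∈tabulate⁺ f {x} fx = lookup⇒[]= x (tabulate f) (trans (lookup∘tabulate f x) fx)

x∈tabulate⁻ : ∀ {n} (f : Fin n → Bool) {x} → x ∈ tabulate f → f x ≡ true
x∈tabulate⁻ f {x} x∈ = trans (sym (lookup∘tabulate f x)) ([]=⇒lookup x∈)

∣p∪q∣≤∣p∣+∣q∣ : ∀ {n} (p q : Subset n) → ∣ p ∪ q ∣ ≤ ∣ p ∣ + ∣ q ∣
∣p∪q∣≤∣p∣+∣q∣ []            []            = z≤n
∣p∪q∣≤∣p∣+∣q∣ (inside  ∷ p) (inside  ∷ q) = s≤s (≤-trans (∣p∪q∣≤∣p∣+∣q∣ p q) (+-monoʳ-≤ ∣ p ∣ (n≤1+n _)))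
∣p∪q∣≤∣p∣+∣q∣ (inside  ∷ p) (outside ∷ q) = s≤s (∣p∪q∣≤∣p∣+∣q∣ p q)
∣p∪q∣≤∣p∣+∣q∣ (outside ∷ p) (inside  ∷ q) = ≤-trans (s≤s (∣p∪q∣≤∣p∣+∣q∣ p q)) (≤-reflexive (sym (+-suc ∣ p ∣ ∣ q ∣)))
∣p∪q∣≤∣p∣+∣q∣ (outside ∷ p) (outside ∷ q) = ∣p∪q∣≤∣p∣+∣q∣ p q

⋃[] : ∀ {n m} → Subset n → (Fin n → Subset m) → Subset m
⋃[] []            F = ∅
⋃[] (inside  ∷ N) F = F zero ∪ ⋃[] N (F ∘ suc)
⋃[] (outside ∷ N) F = ⋃[] N (F ∘ suc)

syntax ⋃[] N (λ c → F) = ⋃[ c ∈ N ] F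

x∈⋃⁺ : ∀ {n m} (N : Subset n) (F : Fin n → Subset m) {c x} → c ∈ N → x ∈ F c → x ∈ ⋃[ c ∈ N ] F c
x∈⋃⁺ (inside  ∷ N) F here        x∈F = x∈p∪q⁺ (inj₁ x∈F)
x∈⋃⁺ (inside  ∷ N) F (there c∈N) x∈F = x∈p∪q⁺ {p = F zero} (inj₂ (x∈⋃⁺ N (F ∘ suc) c∈N x∈F))
x∈⋃⁺ (outside ∷ N) F (there c∈N) x∈F = x∈⋃⁺ N (F ∘ suc) c∈N x∈F

x∈⋃⁻ : ∀ {n m} (N : Subset n) (F : Fin n → Subset m) {x} → x ∈ ⋃[ c ∈ N ] F c → ∃[ c ] (c ∈ N × x ∈ F c)
x∈⋃⁻ []            F x∈ = ⊥-elim (∉⊥ x∈)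
x∈⋃⁻ (inside  ∷ N) F x∈ with x∈p∪q⁻ (F zero) (⋃[] N (F ∘ suc)) x∈
... | inj₁ x∈F = zero , here , x∈F
... | inj₂ x∈⋃ with x∈⋃⁻ N (F ∘ suc) x∈⋃
...   | c , c∈N , x∈F = suc c , there c∈N , x∈F
x∈⋃⁻ (outside ∷ N) F x∈ with x∈⋃⁻ N (F ∘ suc) x∈
... | c , c∈N , x∈F = suc c , there c∈N , x∈F

∣⋃∣≤∣N∣*K : ∀ {n m} (N : Subset n) (F : Fin n → Subset m) {K} →
            (∀ c → ∣ F c ∣ ≤ K) → ∣ ⋃[ c ∈ N ] F c ∣ ≤ ∣ N ∣ * K
∣⋃∣≤∣N∣*K {m = m} [] F bound = ≤-reflexive (∣⊥∣≡0 m)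
∣⋃∣≤∣N∣*K (inside  ∷ N) F bound =
  ≤-trans (∣p∪q∣≤∣p∣+∣q∣ (F zero) (⋃[] N (F ∘ suc)))
          (+-mono-≤ (bound zero) (∣⋃∣≤∣N∣*K N (F ∘ suc) (bound ∘ suc)))
∣⋃∣≤∣N∣*K (outside ∷ N) F bound = ∣⋃∣≤∣N∣*K N (F ∘ suc) (bound ∘ suc)

singletonTree : Tree
singletonTree = record { m = 0 ; parent = λ () ; parent< = λ () }

singleBag-decomposition :
  ∀ {n w} {S : Fin n → Set} {E : Fin n → Fin n → Set} (s : Subset n) →
  (∀ {v} → S v → v ∈ s) → (∀ {v} → v ∈ s → S v) → (∀ {u v} → E u v → S u × S v) →
  ∣ s ∣ ≤ suc w → TwLe S E w
singleBag-decomposition s S⊆s s⊆S E⊆S×S ∣s∣≤ = record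
  { T         = singletonTree
  ; bag       = λ _ → s
  ; bag⊆S     = λ _ _ → s⊆S
  ; coverV    = λ _ v∈S → zero , S⊆s v∈S
  ; coverE    = λ _ _ uv∈E → let u∈S , v∈S = E⊆S×S uv∈E in zero , S⊆s u∈S , S⊆s v∈S
  ; connected = λ { _ zero zero v∈s _ → Tree.here v∈s }
  ; width     = λ _ → ∣s∣≤
  }

module GaifmanBall (𝔄 : Structure) (R? : Decidable (Structure.R 𝔄)) where
  open Structure 𝔄

  gaifmanEdge? : Decidable (GaifmanEdge 𝔄)
  gaifmanEdge? a b = ¬? (a ≟ b) ×-dec (R? a b ⊎-dec R? b a)

  neighbours : Fin size → Subset size
  neighbours a = tabulate (λ b → ⌊ gaifmanEdge? a b ⌋)

  ∈-neighbours⁺ : ∀ {a b} → GaifmanEdge 𝔄 a b → b ∈ neighbours a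
  ∈-neighbours⁺ {a} {b} e = x∈tabulate⁺ _ (isYes-true (gaifmanEdge? a b) e)

  ∈-neighbours⁻ : ∀ {a b} → b ∈ neighbours a → GaifmanEdge 𝔄 a b
  ∈-neighbours⁻ {a} {b} b∈ = toWitness {a? = gaifmanEdge? a b} (Equivalence.from Bool.T-≡ (x∈tabulate⁻ _ b∈))

  ball : ℕ → Fin size → Subset size
  ball zero    a = ⁅ a ⁆
  ball (suc r) a = ball r a ∪ ⋃[ c ∈ neighbours a ] ball r c

  ∈-ball⁺ : ∀ r {a b} → DistLe 𝔄 r a b → b ∈ ball r a
  ∈-ball⁺ zero    {a} refl              = x∈⁅x⁆ a
  ∈-ball⁺ (suc r) (inj₁ near)           = x∈p∪q⁺ (inj₁ (∈-ball⁺ r near))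
  ∈-ball⁺ (suc r) {a} (inj₂ (c , e , p)) =
    x∈p∪q⁺ {p = ball r a} (inj₂ (x∈⋃⁺ (neighbours a) (ball r) (∈-neighbours⁺ e) (∈-ball⁺ r p)))

  ∈-ball⁻ : ∀ r {a b} → b ∈ ball r a → DistLe 𝔄 r a b
  ∈-ball⁻ zero    {a} b∈ = sym (x∈⁅y⁆⇒x≡y a b∈)
  ∈-ball⁻ (suc r) {a} b∈ with x∈p∪q⁻ (ball r a) (⋃[] (neighbours a) (ball r)) b∈
  ... | inj₁ near = inj₁ (∈-ball⁻ r near)
  ... | inj₂ far with x∈⋃⁻ (neighbours a) (ball r) far
  ...   | c , c∈ , b∈c = inj₂ (c , ∈-neighbours⁻ c∈ , ∈-ball⁻ r b∈c)

  module _ {D : ℕ} (degree≤ : ∀ a → ∣ neighbours a ∣ ≤ D) where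

    ∣ball∣≤ : ∀ r a → ∣ ball r a ∣ ≤ suc D ^ r
    ∣ball∣≤ zero    a = ≤-reflexive (∣⁅x⁆∣≡1 a)
    ∣ball∣≤ (suc r) a =
      ≤-trans (∣p∪q∣≤∣p∣+∣q∣ (ball r a) (⋃[] (neighbours a) (ball r)))
        (+-mono-≤ (∣ball∣≤ r a)
          (≤-trans (∣⋃∣≤∣N∣*K (neighbours a) (ball r) (∣ball∣≤ r))
                   (*-monoˡ-≤ (suc D ^ r) (degree≤ a))))

    ltw≤ : ∀ r → LtwLe 𝔄 r (suc D ^ r)
    ltw≤ r a = singleBag-decomposition (ball r a) (∈-ball⁺ r) (∈-ball⁻ r)
                 (λ (u∈ , v∈ , _) → u∈ , v∈) (≤-trans (∣ball∣≤ r a) (n≤1+n _))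

module _ (G : Graph) (d : ℕ) where
  open Graph G using (n; adj)
  open Structure (𝒜 G d) using (R)

  adjacent : Fin n → Subset n
  adjacent a = tabulate (adj a)

  V≤? : ∀ v → Dec (V≤ G d v)
  V≤? v = deg G v ≤? d

  R? : Decidable R
  R? u v = ((adj u v Bool.≟ true)  ×-dec (V≤? u ⊎-dec V≤? v))
           ⊎-dec ((adj u v Bool.≟ false) ×-dec ¬? (V≤? u) ×-dec ¬? (V≤? v) ×-dec ¬? (u ≟ v))

  R-sym : ∀ {u v} → R u v → R v u
  R-sym {u} {v} (inj₁ (e , low))           = inj₁ (trans (Graph.sym G v u) e , swap low)
  R-sym {u} {v} (inj₂ (e , hu , hv , u≢v)) = inj₂ (trans (Graph.sym G v u) e , hv , hu , u≢v ∘ sym)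

  open GaifmanBall (𝒜 G d) R? using (neighbours; ∈-neighbours⁻)

  neighbour⇒R : ∀ {a c} → c ∈ neighbours a → R a c
  neighbour⇒R c∈ with ∈-neighbours⁻ c∈
  ... | _ , inj₁ Rac = Rac
  ... | _ , inj₂ Rca = R-sym Rca

  neighbours-low : ∀ {a} → V≤ G d a → neighbours a ⊆ adjacent a
  neighbours-low low c∈ with neighbour⇒R c∈
  ... | inj₁ (e , _)        = x∈tabulate⁺ _ e
  ... | inj₂ (_ , high , _) = ⊥-elim (high low)

  nonAdjacent : Fin n → Subset n
  nonAdjacent a = ∁ (adjacent a) - a

  ∉-adjacent : ∀ {a c} → adj a c ≡ false → c ∉ adjacent a
  ∉-adjacent e c∈ with trans (sym e) (x∈tabulate⁻ _ c∈)
  ... | ()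

  adjacent-low∈V[1,d] : ∀ {a c} → adj a c ≡ true → V≤ G d c → c ∈ V[1,d] G d
  adjacent-low∈V[1,d] {a} {c} e low =
    x∈tabulate⁺ _ (cong₂ _∧_ (isYes-true (1 ≤? deg G c) deg≥1) (isYes-true (deg G c ≤? d) low))
    where
    a∈ : a ∈ adjacent c
    a∈ = x∈tabulate⁺ _ (trans (Graph.sym G c a) e)
    deg≥1 : 1 ≤ deg G c
    deg≥1 = ≤-trans (s≤s z≤n) (x∈p⇒∣p-x∣<∣p∣ a∈)

  neighbours-high : ∀ {a} → ¬ V≤ G d a → neighbours a ⊆ V[1,d] G d ∪ nonAdjacent a
  neighbours-high high c∈ with neighbour⇒R c∈
  ... | inj₁ (_ , inj₁ low)    = ⊥-elim (high low)
  ... | inj₁ (e , inj₂ low)    = x∈p∪q⁺ (inj₁ (adjacent-low∈V[1,d] e low))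
  ... | inj₂ (e , _ , _ , a≢c) =
    x∈p∪q⁺ {p = V[1,d] G d} (inj₂ (x∈p∧x≢y⇒x∈p-y (x∉p⇒x∈∁p (∉-adjacent e)) (a≢c ∘ sym)))

  ∣nonAdjacent∣≤d : ∀ {a} → n ∸ 1 ∸ d ≤ deg G a → ∣ nonAdjacent a ∣ ≤ d
  ∣nonAdjacent∣≤d {a} dense = s≤s⁻¹ (begin
    suc ∣ nonAdjacent a ∣       ≤⟨ x∈p⇒∣p-x∣<∣p∣ (x∉p⇒x∈∁p (∉-adjacent (Graph.irrefl G a))) ⟩
    ∣ ∁ (adjacent a) ∣          ≡⟨ ∣∁p∣≡n∸∣p∣ (adjacent a) ⟩
    n ∸ deg G a                 ≤⟨ m≤n+o⇒m∸n≤o n (deg G a) n≤deg+1+d ⟩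
    suc d                       ∎)
    where
    open ≤-Reasoning
    n≤deg+1+d : n ≤ deg G a + suc d
    n≤deg+1+d = begin
      n                    ≤⟨ m≤n+m∸n n (suc d) ⟩
      suc d + (n ∸ suc d)  ≤⟨ +-monoʳ-≤ (suc d) (≤-trans (≤-reflexive (sym (∸-+-assoc n 1 d))) dense) ⟩
      suc d + deg G a      ≡⟨ +-comm (suc d) (deg G a) ⟩
      deg G a + suc d      ∎

  low-or-dense : DegreeExtreme G d → ∀ a → V≤ G d a ⊎ (¬ V≤ G d a × n ∸ 1 ∸ d ≤ deg G a)
  low-or-dense extreme a with V≤? a | extreme a
  ... | yes low  | _          = inj₁ low
  ... | no  high | inj₁ low   = ⊥-elim (high low)
  ... | no  high | inj₂ dense = inj₂ (high , dense)

  ∣neighbours∣≤ : DegreeExtreme G d → ∀ a → ∣ neighbours a ∣ ≤ d + ∣ V[1,d] G d ∣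
  ∣neighbours∣≤ extreme a with low-or-dense extreme a
  ... | inj₁ low            = ≤-trans (p⊆q⇒∣p∣≤∣q∣ (neighbours-low low)) (≤-trans low (m≤m+n d _))
  ... | inj₂ (high , dense) = begin
    ∣ neighbours a ∣                    ≤⟨ p⊆q⇒∣p∣≤∣q∣ (neighbours-high high) ⟩
    ∣ V[1,d] G d ∪ nonAdjacent a ∣      ≤⟨ ∣p∪q∣≤∣p∣+∣q∣ (V[1,d] G d) _ ⟩
    ∣ V[1,d] G d ∣ + ∣ nonAdjacent a ∣  ≤⟨ +-monoʳ-≤ ∣ V[1,d] G d ∣ (∣nonAdjacent∣≤d dense) ⟩
    ∣ V[1,d] G d ∣ + d                  ≡⟨ +-comm ∣ V[1,d] G d ∣ d ⟩
    d + ∣ V[1,d] G d ∣                  ∎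
    where open ≤-Reasoning

degreeBound : ℕ → ℕ⁺ → ℕ
degreeBound d k = d + (d + 1) * ((proj₁ k ∸ 1) ^ 2)

h₀ : ℕ → ℕ → ℕ⁺ → ℕ⁺
h₀ r d k = suc (degreeBound d k) ^ r , m^n≢0 (suc (degreeBound d k)) r

lemma4p4 : Σ[ h₀ ∈ (ℕ → ℕ → ℕ⁺ → ℕ⁺) ]
             (∀ (d : ℕ) (k : ℕ⁺) (G : Graph) → DegreeExtreme G d →
                ((d + 1) * ((proj₁ k ∸ 1) ^ 2) < ∣ V[1,d] G d ∣)
                ⊎ (∀ (r : ℕ) → LtwLe (𝒜 G d) r (proj₁ (h₀ r d k))))
lemma4p4 = h₀ , λ d k G extreme → case ∣ V[1,d] G d ∣ ≤? (d + 1) * ((proj₁ k ∸ 1) ^ 2) of λ where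
  (no many) → inj₁ (≰⇒> many)
  (yes few) → inj₂ (GaifmanBall.ltw≤ (𝒜 G d) (R? G d)
                      (λ a → ≤-trans (∣neighbours∣≤ G d extreme a) (+-monoʳ-≤ d few)))
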